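{- Let $k\ge 2$ be an integer. Every finite simple graph $G$ is (isomorphic to) an induced subgraph of some graph $H$ that admits a closed neighborhood balanced $k$-coloring.
   Context: All graphs are finite and simple. For a vertex $v$, $N[v]$ denotes the closed neighborhood (the vertex together with its neighbors). A closed neighborhood balanced $k$-coloring of a graph $H$ is a map $c:V(H)\to\{1,\dots,k\}$ such that for every vertex $v$ the numbers $|N[v]\cap c^{ -1}(i)|$, $i=1,\dots,k$, are all equal. -}

module Defs where

open import Data.Nat using (ℕ; zero; suc; _+_)
open import Data.Bool using (Bool; true; false; _∨_; _∧_; not)
open import Data.Fin using (Fin; zero; suc)
open import Data.Fin.Properties using (_≟_)
open import Data.Vec.Functional using (Vector)
open import Relation.Nullary.Decidable using (⌊_⌋)
open import Relation.Binary.PropositionalEquality using (_≡_)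
open import Function.Definitions using (Injective)

record Graph (n : ℕ) : Set where
  field
    adj   : Fin n → Fin n → Bool
    sym   : ∀ u v → adj u v ≡ adj v u
    irrefl : ∀ v → adj v v ≡ false
open Graph public

count : ∀ {n} → (Fin n → Bool) → ℕ
count {zero}  p = 0
count {suc n} p = if′ (p zero) + count (λ i → p (suc i))
  where
  if′ : Bool → ℕ
  if′ true  = 1
  if′ false = 0

inN[_] : ∀ {n} (H : Graph n) → Fin n → Fin n → Bool
inN[ H ] v u = ⌊ u ≟ v ⌋ ∨ adj H v u

nbhdColorCount : ∀ {n k} (H : Graph n) (c : Fin n → Fin k) → Fin n → Fin k → ℕ
nbhdColorCount H c v i = count (λ u → inN[ H ] v u ∧ ⌊ c u ≟ i ⌋)

IsCNBalancedColoring : ∀ {n} (k : ℕ) (H : Graph n) → (Fin n → Fin k) → Set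
IsCNBalancedColoring k H c =
  ∀ v (i j : Fin k) → nbhdColorCount H c v i ≡ nbhdColorCount H c v j

record InducedEmbedding {m n : ℕ} (G : Graph m) (H : Graph n) : Set where
  field
    f     : Fin m → Fin n
    inj   : Injective _≡_ _≡_ f
    preserves : ∀ x y → adj H (f x) (f y) ≡ adj G x y

-- Replace every vertex v of G by a clique {v} × Fin k and join (v , i) to (w , j) whenever
-- v ~ w: the lexicographic product G[Kₖ]. The closed neighbourhood of (v , i) is then
-- N[v] × Fin k, which meets every colour class j ↦ (· , j) in exactly |N[v]| vertices,
-- and each layer v ↦ (v , i) is an induced copy of G.
module Submission where

open import Defs hiding (sym)
open import Data.Bool using (Bool; true; false; _∨_; _∧_; if_then_else_)
open import Data.Fin using (Fin; zero; suc; combine; remQuot; _↑ˡ_; _↑ʳ_)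
open import Data.Fin.Properties
  using (_≟_; suc-injective; remQuot-combine; combine-surjective; combine-injectiveˡ; combine-injectiveʳ)
open import Data.Nat using (ℕ; zero; suc; _+_; _*_; _≥_)
open import Data.Nat.Properties using (+-assoc)
open import Data.Product using (Σ; ∃; _×_; _,_; proj₂)
open import Function using (_∘_)
open import Relation.Nullary using (¬_; Dec; yes; no)
open import Relation.Nullary.Decidable using (⌊_⌋; ⌊⌋-map′; isYes≗does; dec-true; dec-false)
open import Relation.Binary.PropositionalEquality
  using (_≡_; refl; sym; trans; cong; cong₂; module ≡-Reasoning)

open ≡-Reasoning

⌊⌋-true : ∀ {p} {P : Set p} (P? : Dec P) → P → ⌊ P? ⌋ ≡ true
⌊⌋-true P? p = trans (isYes≗does P?) (dec-true P? p)

⌊⌋-false : ∀ {p} {P : Set p} (P? : Dec P) → ¬ P → ⌊ P? ⌋ ≡ false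
⌊⌋-false P? ¬p = trans (isYes≗does P?) (dec-false P? ¬p)

⌊≟⌋-sym : ∀ {n} (v w : Fin n) → ⌊ v ≟ w ⌋ ≡ ⌊ w ≟ v ⌋
⌊≟⌋-sym v w with v ≟ w
... | yes refl = sym (⌊⌋-true (v ≟ v) refl)
... | no v≢w   = sym (⌊⌋-false (w ≟ v) (v≢w ∘ sym))

inN-sym : ∀ {n} (G : Graph n) v w → inN[ G ] v w ≡ inN[ G ] w v
inN-sym G v w = cong₂ _∨_ (⌊≟⌋-sym w v) (Graph.sym G v w)

boolToℕ : Bool → ℕ
boolToℕ true  = 1
boolToℕ false = 0

count-suc : ∀ {n} (p : Fin (suc n) → Bool) → count p ≡ boolToℕ (p zero) + count (p ∘ suc)
count-suc p with p zero
... | true  = refl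
... | false = refl

count-cong : ∀ {n} {p q : Fin n → Bool} → (∀ i → p i ≡ q i) → count p ≡ count q
count-cong {zero}          p≗q = refl
count-cong {suc n} {p} {q} p≗q = begin
  count p                             ≡⟨ count-suc p ⟩
  boolToℕ (p zero) + count (p ∘ suc)  ≡⟨ cong₂ _+_ (cong boolToℕ (p≗q zero)) (count-cong (p≗q ∘ suc)) ⟩
  boolToℕ (q zero) + count (q ∘ suc)  ≡⟨ sym (count-suc q) ⟩
  count q                             ∎

count-false : ∀ n → count {n} (λ _ → false) ≡ 0
count-false zero    = refl
count-false (suc n) = count-false n

count-↑ : ∀ a {b} (p : Fin (a + b) → Bool) →
          count p ≡ count (λ i → p (i ↑ˡ b)) + count (λ j → p (a ↑ʳ j))
count-↑ zero        p = refl
count-↑ (suc a) {b} p = begin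
  count p                                   ≡⟨ count-suc p ⟩
  boolToℕ (p zero) + count (p ∘ suc)        ≡⟨ cong (boolToℕ (p zero) +_) (count-↑ a (p ∘ suc)) ⟩
  boolToℕ (p zero) + (countˡ + countʳ)      ≡⟨ sym (+-assoc (boolToℕ (p zero)) _ _) ⟩
  boolToℕ (p zero) + countˡ + countʳ        ≡⟨ cong (_+ countʳ) (sym (count-suc (λ i → p (i ↑ˡ b)))) ⟩
  count (λ i → p (i ↑ˡ b)) + countʳ         ∎
  where
  countˡ : ℕ
  countˡ = count (λ i → p (suc (i ↑ˡ b)))
  countʳ : ℕ
  countʳ = count (λ j → p (suc a ↑ʳ j))

count-combine : ∀ m {k} (p : Fin (m * k) → Bool) (q : Fin m → Bool) →
                (∀ w → count (λ j → p (combine w j)) ≡ boolToℕ (q w)) →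
                count p ≡ count q
count-combine zero        p q fibre = refl
count-combine (suc m) {k} p q fibre = begin
  count p                                                       ≡⟨ count-↑ k p ⟩
  count (λ j → p (j ↑ˡ m * k)) + count (λ j → p (k ↑ʳ j))       ≡⟨ cong₂ _+_ (fibre zero) rest ⟩
  boolToℕ (q zero) + count (q ∘ suc)                            ≡⟨ sym (count-suc q) ⟩
  count q                                                       ∎
  where
  rest : count (λ j → p (k ↑ʳ j)) ≡ count (q ∘ suc)
  rest = count-combine m (λ j → p (k ↑ʳ j)) (q ∘ suc) (fibre ∘ suc)

count-≟ : ∀ {n} (c : Fin n) → count (λ j → ⌊ j ≟ c ⌋) ≡ 1
count-≟ {suc n} zero    = cong suc (count-false n)
count-≟ {suc n} (suc c) =
  trans (count-cong (λ i → ⌊⌋-map′ (cong suc) suc-injective (i ≟ c))) (count-≟ c)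

count-∧-≟ : ∀ {n} b (c : Fin n) → count (λ j → b ∧ ⌊ j ≟ c ⌋) ≡ boolToℕ b
count-∧-≟ true      c = count-≟ c
count-∧-≟ {n} false c = count-false n

⌊combine≟combine⌋ : ∀ {m k} (v w : Fin m) (i : Fin k) → ⌊ combine v i ≟ combine w i ⌋ ≡ ⌊ v ≟ w ⌋
⌊combine≟combine⌋ v w i with v ≟ w
... | yes refl = ⌊⌋-true (combine v i ≟ combine v i) refl
... | no v≢w   = ⌊⌋-false (combine v i ≟ combine w i) (v≢w ∘ combine-injectiveˡ v i w i)

module LexicographicProduct (k : ℕ) {m} (G : Graph m) where

  lexAdj : Fin m × Fin k → Fin m × Fin k → Bool
  lexAdj (v , i) (w , j) = if ⌊ i ≟ j ⌋ then adj G v w else inN[ G ] v w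

  lexAdj-sym : ∀ x y → lexAdj x y ≡ lexAdj y x
  lexAdj-sym (v , i) (w , j) rewrite ⌊≟⌋-sym i j with ⌊ j ≟ i ⌋
  ... | true  = Graph.sym G v w
  ... | false = inN-sym G v w

  lexAdj-irrefl : ∀ x → lexAdj x x ≡ false
  lexAdj-irrefl (v , i) rewrite ⌊⌋-true (i ≟ i) refl = Graph.irrefl G v

  G[Kₖ] : Graph (m * k)
  G[Kₖ] = record
    { adj    = λ x y → lexAdj (remQuot k x) (remQuot k y)
    ; sym    = λ x y → lexAdj-sym (remQuot k x) (remQuot k y)
    ; irrefl = λ x → lexAdj-irrefl (remQuot k x)
    }

  layer : Fin (m * k) → Fin k
  layer x = proj₂ (remQuot {m} k x)

  layer-combine : ∀ v i → layer (combine v i) ≡ i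
  layer-combine v i = cong proj₂ (remQuot-combine {m} {k} v i)

  adj-combine : ∀ v i w j → adj G[Kₖ] (combine v i) (combine w j) ≡ lexAdj (v , i) (w , j)
  adj-combine v i w j = cong₂ lexAdj (remQuot-combine {m} {k} v i) (remQuot-combine {m} {k} w j)

  inN-combine : ∀ v i w j → inN[ G[Kₖ] ] (combine v i) (combine w j) ≡ inN[ G ] v w
  inN-combine v i w j rewrite adj-combine v i w j with i ≟ j
  ... | yes refl = cong (_∨ adj G v w) (⌊combine≟combine⌋ w v i)
  ... | no i≢j   = cong (_∨ inN[ G ] v w)
                        (⌊⌋-false (combine w j ≟ combine v i) (i≢j ∘ sym ∘ combine-injectiveʳ w j v i))

  nbhdColorCount-combine : ∀ v i c → nbhdColorCount G[Kₖ] layer (combine v i) c ≡ count (inN[ G ] v)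
  nbhdColorCount-combine v i c = count-combine m (λ y → inN[ G[Kₖ] ] (combine v i) y ∧ ⌊ layer y ≟ c ⌋) (inN[ G ] v) λ w → begin
    count (λ j → inN[ G[Kₖ] ] (combine v i) (combine w j) ∧ ⌊ layer (combine w j) ≟ c ⌋)
      ≡⟨ count-cong (λ j → cong₂ (λ b l → b ∧ ⌊ l ≟ c ⌋) (inN-combine v i w j) (layer-combine w j)) ⟩
    count (λ j → inN[ G ] v w ∧ ⌊ j ≟ c ⌋)
      ≡⟨ count-∧-≟ (inN[ G ] v w) c ⟩
    boolToℕ (inN[ G ] v w)
      ∎

  layer-balanced : IsCNBalancedColoring k G[Kₖ] layer
  layer-balanced x c d with v , i , refl ← combine-surjective {m} x =
    trans (nbhdColorCount-combine v i c) (sym (nbhdColorCount-combine v i d))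

  layer-embedding : Fin k → InducedEmbedding G G[Kₖ]
  layer-embedding i = record
    { f         = λ v → combine v i
    ; inj       = λ {v} {w} → combine-injectiveˡ v i w i
    ; preserves = λ v w → trans (adj-combine v i w i)
                                (cong (if_then adj G v w else _) (⌊⌋-true (i ≟ i) refl))
    }

theorem2p6 : (k : ℕ) → k ≥ 2 → ∀ {m} (G : Graph m) →
    Σ ℕ (λ n → Σ (Graph n) (λ H →
      InducedEmbedding G H × ∃ (λ (c : Fin n → Fin k) → IsCNBalancedColoring k H c)))
theorem2p6 (suc k) _ G = _ , G[Kₖ] , layer-embedding zero , layer , layer-balanced
  where open LexicographicProduct (suc k) G
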